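{- For every formula $\alpha$ of the language $\{\vee,\wedge,\neg,\square\}$: if $\vdash_{\mathbb T'}\alpha$, then $\models_{\cal TML}\alpha$.
   Context: $\mathfrak M_{4m}$ is the lattice $M_4=\{\mathbf 0,\mathbf n,\mathbf b,\mathbf 1\}$ ($\mathbf 0<\mathbf n,\mathbf b<\mathbf 1$, $\mathbf n,\mathbf b$ incomparable) with $\neg\mathbf 0=\mathbf 1$, $\neg\mathbf 1=\mathbf 0$, $\neg\mathbf n=\mathbf n$, $\neg\mathbf b=\mathbf b$, $\square\mathbf 1=\mathbf 1$, $\square x=\mathbf 0$ for $x\ne\mathbf 1$; it generates the variety of tetravalent modal algebras. Formulas are built from propositional variables with $\vee,\wedge,\neg,\square$; a valuation is a homomorphism $h$ into $\mathfrak M_{4m}$; $\models_{\cal TML}\alpha$ means $h(\alpha)=\mathbf 1$ for every valuation $h$. Signed formulas: $T(\alpha)$, $F(\alpha)$. Rules of $\mathbb T'$ (premise $\Rightarrow$ conclusion sets separated by $|$): $T(\alpha\vee\beta)\Rightarrow\{T(\alpha)\}|\{T(\beta)\}$; $T(\neg(\alpha\vee\beta))\Rightarrow\{T(\neg\alpha),T(\neg\beta)\}$; $F(\alpha\vee\beta)\Rightarrow\{F(\alpha),F(\beta)\}$; $F(\neg(\alpha\vee\beta))\Rightarrow\{F(\neg\alpha)\}|\{F(\neg\beta)\}$; $T(\alpha\wedge\beta)\Rightarrow\{T(\alpha),T(\beta)\}$; $T(\neg(\alpha\wedge\beta))\Rightarrow\{T(\neg\alpha)\}|\{T(\neg\beta)\}$;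 $F(\alpha\wedge\beta)\Rightarrow\{F(\alpha)\}|\{F(\beta)\}$; $F(\neg(\alpha\wedge\beta))\Rightarrow\{F(\neg\alpha),F(\neg\beta)\}$; $T(\neg\neg\alpha)\Rightarrow\{T(\alpha)\}$; $F(\neg\neg\alpha)\Rightarrow\{F(\alpha)\}$; $T(\square\alpha)\Rightarrow\{T(\alpha),F(\neg\alpha)\}$; $F(\square\alpha)\Rightarrow\{F(\alpha)\}|\{T(\neg\alpha)\}$; $T(\neg\square\alpha)\Rightarrow\{F(\square\alpha)\}$; $F(\neg\square\alpha)\Rightarrow\{T(\square\alpha)\}$. A tableau for $\eta$ is a finite tree with root $\eta$ built by repeatedly choosing a non-closed branch and a signed formula on it that is a rule premise, and extending the branch by one sub-branch per conclusion set. A branch is closed if it contains $T(\gamma)$ and $F(\gamma)$ for some $\gamma$; a tableau is closed if all branches are closed. $\vdash_{\mathbb T'}\alpha$ means there is a closed tableau of $\mathbb T'$ for $F(\alpha)$. -}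

module Defs where

open import Data.Nat using (ℕ)
open import Data.List using (List; []; _∷_; _++_; map)
open import Data.List.Membership.Propositional using (_∈_)
open import Data.List.Relation.Unary.All using (All)
open import Data.Product using (∃; _×_)
open import Relation.Binary.PropositionalEquality using (_≡_)
open import Relation.Nullary using (¬_)

data Formula : Set where
  var  : ℕ → Formula
  _∨′_ : Formula → Formula → Formula
  _∧′_ : Formula → Formula → Formula
  ¬′_  : Formula → Formula
  □_   : Formula → Formula

data M4 : Set where
  𝟘 𝕟 𝕓 𝟙 : M4

_⊔_ : M4 → M4 → M4
𝟘 ⊔ y = y
𝟙 ⊔ y = 𝟙
𝕟 ⊔ 𝟘 = 𝕟
𝕟 ⊔ 𝕟 = 𝕟
𝕟 ⊔ 𝕓 = 𝟙
𝕟 ⊔ 𝟙 = 𝟙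
𝕓 ⊔ 𝟘 = 𝕓
𝕓 ⊔ 𝕟 = 𝟙
𝕓 ⊔ 𝕓 = 𝕓
𝕓 ⊔ 𝟙 = 𝟙

_⊓_ : M4 → M4 → M4
𝟘 ⊓ y = 𝟘
𝟙 ⊓ y = y
𝕟 ⊓ 𝟘 = 𝟘
𝕟 ⊓ 𝕟 = 𝕟
𝕟 ⊓ 𝕓 = 𝟘
𝕟 ⊓ 𝟙 = 𝕟
𝕓 ⊓ 𝟘 = 𝟘
𝕓 ⊓ 𝕟 = 𝟘
𝕓 ⊓ 𝕓 = 𝕓
𝕓 ⊓ 𝟙 = 𝕓

∼_ : M4 → M4
∼ 𝟘 = 𝟙
∼ 𝕟 = 𝕟
∼ 𝕓 = 𝕓
∼ 𝟙 = 𝟘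

■_ : M4 → M4
■ 𝟙 = 𝟙
■ 𝟘 = 𝟘
■ 𝕟 = 𝟘
■ 𝕓 = 𝟘

-- A valuation is a homomorphism from the (absolutely free) formula algebra
-- into M_4m; it is uniquely determined by its values on the variables.
⟦_⟧ : Formula → (ℕ → M4) → M4
⟦ var n ⟧ v = v n
⟦ α ∨′ β ⟧ v = ⟦ α ⟧ v ⊔ ⟦ β ⟧ v
⟦ α ∧′ β ⟧ v = ⟦ α ⟧ v ⊓ ⟦ β ⟧ v
⟦ ¬′ α ⟧ v = ∼ ⟦ α ⟧ v
⟦ □ α ⟧ v = ■ ⟦ α ⟧ v

⊨TML : Formula → Set
⊨TML α = ∀ (v : ℕ → M4) → ⟦ α ⟧ v ≡ 𝟙

data Signed : Set where
  T F : Formula → Signed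

-- Rules of 𝕋′ : premise ⇒ list of conclusion sets (one per sub-branch)
data Rule : Signed → List (List Signed) → Set where
  T∨  : ∀ α β → Rule (T (α ∨′ β)) ((T α ∷ []) ∷ (T β ∷ []) ∷ [])
  T¬∨ : ∀ α β → Rule (T (¬′ (α ∨′ β))) ((T (¬′ α) ∷ T (¬′ β) ∷ []) ∷ [])
  F∨  : ∀ α β → Rule (F (α ∨′ β)) ((F α ∷ F β ∷ []) ∷ [])
  F¬∨ : ∀ α β → Rule (F (¬′ (α ∨′ β))) ((F (¬′ α) ∷ []) ∷ (F (¬′ β) ∷ []) ∷ [])
  T∧  : ∀ α β → Rule (T (α ∧′ β)) ((T α ∷ T β ∷ []) ∷ [])
  T¬∧ : ∀ α β → Rule (T (¬′ (α ∧′ β))) ((T (¬′ α) ∷ []) ∷ (T (¬′ β) ∷ []) ∷ [])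
  F∧  : ∀ α β → Rule (F (α ∧′ β)) ((F α ∷ []) ∷ (F β ∷ []) ∷ [])
  F¬∧ : ∀ α β → Rule (F (¬′ (α ∧′ β))) ((F (¬′ α) ∷ F (¬′ β) ∷ []) ∷ [])
  T¬¬ : ∀ α → Rule (T (¬′ (¬′ α))) ((T α ∷ []) ∷ [])
  F¬¬ : ∀ α → Rule (F (¬′ (¬′ α))) ((F α ∷ []) ∷ [])
  T□  : ∀ α → Rule (T (□ α)) ((T α ∷ F (¬′ α) ∷ []) ∷ [])
  F□  : ∀ α → Rule (F (□ α)) ((F α ∷ []) ∷ (T (¬′ α) ∷ []) ∷ [])
  T¬□ : ∀ α → Rule (T (¬′ (□ α))) ((F (□ α) ∷ []) ∷ [])
  F¬□ : ∀ α → Rule (F (¬′ (□ α))) ((T (□ α) ∷ []) ∷ [])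

Branch : Set
Branch = List Signed

ClosedBranch : Branch → Set
ClosedBranch b = ∃ λ γ → (T γ ∈ b) × (F γ ∈ b)

-- A tableau is represented by the list of its branches (root-to-leaf paths).
data Tableau (η : Signed) : List Branch → Set where
  root   : Tableau η ((η ∷ []) ∷ [])
  expand : ∀ {pre post b φ cs} →
           Tableau η (pre ++ b ∷ post) →
           ¬ ClosedBranch b →
           φ ∈ b →
           Rule φ cs →
           Tableau η (pre ++ map (b ++_) cs ++ post)

ClosedTableau : List Branch → Set
ClosedTableau ts = All ClosedBranch ts

⊢T′ : Formula → Set
⊢T′ α = ∃ λ ts → Tableau (F α) ts × ClosedTableau ts

-- M_4m has exactly two prime filters, ↑𝕟 = {𝕟, 𝟙} and ↑𝕓 = {𝕓, 𝟙}, and 𝟙 is the only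
-- element lying in both.  Read T γ as "the value of γ lies in the prime filter D" and
-- F γ as "it does not".  Membership in D commutes with ⊔ and ⊓, ∼ x lies in D exactly
-- when x misses the other prime filter, and ■ x lies in D exactly when x lies in both.
-- Hence every rule of 𝕋′ is invertible: its premise holds iff one of its conclusion
-- sets does.  So expanding a tableau never loses a satisfied branch, a closed tableau
-- has none, and a closed tableau for F(α) forces ⟦ α ⟧ v into both prime filters.
module Submission where

open import Defs
open import Data.Bool using (Bool; true; false; not; _∧_; _∨_) renaming (T to IsTrue)
open import Data.Bool.Properties
  using (∧-identityʳ; ∨-identityʳ; not-involutive; ∨-∧-booleanAlgebra)
open import Algebra.Lattice.Properties.BooleanAlgebra ∨-∧-booleanAlgebra using (deMorgan₁; deMorgan₂)
open import Data.Empty using (⊥)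
open import Data.Bool.ListAction using (any; all)
open import Data.List using ([]; _∷_; _++_; map)
open import Data.List.Relation.Unary.All as All using (All; _∷_)
open import Data.List.Relation.Unary.All.Properties using (++⁺; all⁺)
open import Data.List.Relation.Unary.Any as Any using (Any; here; there)
open import Data.List.Relation.Unary.Any.Properties using (++⁻; ++⁺ˡ; ++⁺ʳ; map⁺; any⁻)
open import Data.Nat using (ℕ)
open import Data.Product using (_,_)
open import Data.Sum using (inj₁; inj₂)
open import Function using (_∘_)
open import Relation.Binary.PropositionalEquality
  using (_≡_; refl; sym; trans; cong; cong₂; subst; module ≡-Reasoning)
open import Relation.Nullary using (¬_)

module TableauSoundness
  (Sat : Signed → Set)
  (rule-sound : ∀ {φ cs} → Rule φ cs → Sat φ → Any (All Sat) cs)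
  (consistent : ∀ γ → Sat (T γ) → Sat (F γ) → ⊥)
  where

  satisfied-branch : ∀ {η ts} → Tableau η ts → Sat η → Any (All Sat) ts
  satisfied-branch root sat = here (sat ∷ All.[])
  satisfied-branch (expand {pre} {post} {b} {cs = cs} t _ φ∈b r) sat
    with ++⁻ pre (satisfied-branch t sat)
  ... | inj₁ in-pre = ++⁺ˡ in-pre
  ... | inj₂ (there in-post) = ++⁺ʳ pre (++⁺ʳ (map (b ++_) cs) in-post)
  ... | inj₂ (here sat-b) =
    ++⁺ʳ pre (++⁺ˡ (map⁺ (Any.map (++⁺ sat-b) (rule-sound r (All.lookup sat-b φ∈b)))))

  closed-branch-unsatisfiable : ∀ {b} → ClosedBranch b → ¬ All Sat b
  closed-branch-unsatisfiable (γ , T∈b , F∈b) sat =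
    consistent γ (All.lookup sat T∈b) (All.lookup sat F∈b)

  closed-tableau-refutes : ∀ {η ts} → Tableau η ts → ClosedTableau ts → ¬ Sat η
  closed-tableau-refutes t closed sat =
    All.lookupWith closed-branch-unsatisfiable closed (satisfied-branch t sat)

data PrimeFilter : Set where
  ↑𝕟 ↑𝕓 : PrimeFilter

opposite : PrimeFilter → PrimeFilter
opposite ↑𝕟 = ↑𝕓
opposite ↑𝕓 = ↑𝕟

_∈ᵇ_ : M4 → PrimeFilter → Bool
𝟙 ∈ᵇ _ = true
𝟘 ∈ᵇ _ = false
𝕟 ∈ᵇ ↑𝕟 = true
𝕟 ∈ᵇ ↑𝕓 = false
𝕓 ∈ᵇ ↑𝕟 = false
𝕓 ∈ᵇ ↑𝕓 = true

_∉ᵇ_ : M4 → PrimeFilter → Bool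
x ∉ᵇ D = not (x ∈ᵇ D)

∈-⊔ : ∀ D x y → (x ⊔ y) ∈ᵇ D ≡ x ∈ᵇ D ∨ y ∈ᵇ D
∈-⊔ _  𝟘 _ = refl
∈-⊔ _  𝟙 _ = refl
∈-⊔ ↑𝕟 𝕟 𝟘 = refl
∈-⊔ ↑𝕟 𝕟 𝕟 = refl
∈-⊔ ↑𝕟 𝕟 𝕓 = refl
∈-⊔ ↑𝕟 𝕟 𝟙 = refl
∈-⊔ ↑𝕓 𝕟 𝟘 = refl
∈-⊔ ↑𝕓 𝕟 𝕟 = refl
∈-⊔ ↑𝕓 𝕟 𝕓 = refl
∈-⊔ ↑𝕓 𝕟 𝟙 = refl
∈-⊔ ↑𝕟 𝕓 𝟘 = refl
∈-⊔ ↑𝕟 𝕓 𝕟 = refl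
∈-⊔ ↑𝕟 𝕓 𝕓 = refl
∈-⊔ ↑𝕟 𝕓 𝟙 = refl
∈-⊔ ↑𝕓 𝕓 𝟘 = refl
∈-⊔ ↑𝕓 𝕓 𝕟 = refl
∈-⊔ ↑𝕓 𝕓 𝕓 = refl
∈-⊔ ↑𝕓 𝕓 𝟙 = refl

∈-⊓ : ∀ D x y → (x ⊓ y) ∈ᵇ D ≡ x ∈ᵇ D ∧ y ∈ᵇ D
∈-⊓ _  𝟘 _ = refl
∈-⊓ _  𝟙 _ = refl
∈-⊓ ↑𝕟 𝕟 𝟘 = refl
∈-⊓ ↑𝕟 𝕟 𝕟 = refl
∈-⊓ ↑𝕟 𝕟 𝕓 = refl
∈-⊓ ↑𝕟 𝕟 𝟙 = refl
∈-⊓ ↑𝕓 𝕟 𝟘 = refl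
∈-⊓ ↑𝕓 𝕟 𝕟 = refl
∈-⊓ ↑𝕓 𝕟 𝕓 = refl
∈-⊓ ↑𝕓 𝕟 𝟙 = refl
∈-⊓ ↑𝕟 𝕓 𝟘 = refl
∈-⊓ ↑𝕟 𝕓 𝕟 = refl
∈-⊓ ↑𝕟 𝕓 𝕓 = refl
∈-⊓ ↑𝕟 𝕓 𝟙 = refl
∈-⊓ ↑𝕓 𝕓 𝟘 = refl
∈-⊓ ↑𝕓 𝕓 𝕟 = refl
∈-⊓ ↑𝕓 𝕓 𝕓 = refl
∈-⊓ ↑𝕓 𝕓 𝟙 = refl

∈-∼ : ∀ D x → (∼ x) ∈ᵇ D ≡ x ∉ᵇ opposite D
∈-∼ _  𝟘 = refl
∈-∼ _  𝟙 = refl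
∈-∼ ↑𝕟 𝕟 = refl
∈-∼ ↑𝕟 𝕓 = refl
∈-∼ ↑𝕓 𝕟 = refl
∈-∼ ↑𝕓 𝕓 = refl

∈-■ : ∀ D x → (■ x) ∈ᵇ D ≡ x ∈ᵇ D ∧ x ∈ᵇ opposite D
∈-■ _  𝟘 = refl
∈-■ _  𝟙 = refl
∈-■ ↑𝕟 𝕟 = refl
∈-■ ↑𝕟 𝕓 = refl
∈-■ ↑𝕓 𝕟 = refl
∈-■ ↑𝕓 𝕓 = refl

∼-involutive : ∀ x → ∼ ∼ x ≡ x
∼-involutive 𝟘 = refl
∼-involutive 𝕟 = refl
∼-involutive 𝕓 = refl
∼-involutive 𝟙 = refl

∈-■-independent : ∀ D E x → (■ x) ∈ᵇ D ≡ (■ x) ∈ᵇ E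
∈-■-independent _ _ 𝟘 = refl
∈-■-independent _ _ 𝕟 = refl
∈-■-independent _ _ 𝕓 = refl
∈-■-independent _ _ 𝟙 = refl

in-every-prime-filter⇒≡𝟙 : ∀ x → (∀ D → ¬ IsTrue (x ∉ᵇ D)) → x ≡ 𝟙
in-every-prime-filter⇒≡𝟙 𝟙 _ = refl
in-every-prime-filter⇒≡𝟙 𝟘 never-outside with () ← never-outside ↑𝕟 _
in-every-prime-filter⇒≡𝟙 𝕟 never-outside with () ← never-outside ↑𝕓 _
in-every-prime-filter⇒≡𝟙 𝕓 never-outside with () ← never-outside ↑𝕟 _

module _ {a} {A : Set a} (p : A → Bool) where

  any-all-[x] : ∀ x → any (all p) ((x ∷ []) ∷ []) ≡ p x
  any-all-[x] x = trans (∨-identityʳ _) (∧-identityʳ (p x))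

  any-all-[x,y] : ∀ x y → any (all p) ((x ∷ y ∷ []) ∷ []) ≡ p x ∧ p y
  any-all-[x,y] x y = trans (∨-identityʳ _) (cong (p x ∧_) (∧-identityʳ (p y)))

  any-all-[x]-[y] : ∀ x y → any (all p) ((x ∷ []) ∷ (y ∷ []) ∷ []) ≡ p x ∨ p y
  any-all-[x]-[y] x y = cong₂ _∨_ (∧-identityʳ (p x)) (any-all-[x] y)

module _ (v : ℕ → M4) where
  open ≡-Reasoning

  holds : PrimeFilter → Signed → Bool
  holds D (T α) = ⟦ α ⟧ v ∈ᵇ D
  holds D (F α) = ⟦ α ⟧ v ∉ᵇ D

  holds-T∨ : ∀ D α β → holds D (T (α ∨′ β)) ≡ holds D (T α) ∨ holds D (T β)
  holds-T∨ D α β = ∈-⊔ D (⟦ α ⟧ v) (⟦ β ⟧ v)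

  holds-F∨ : ∀ D α β → holds D (F (α ∨′ β)) ≡ holds D (F α) ∧ holds D (F β)
  holds-F∨ D α β = trans (cong not (holds-T∨ D α β)) (deMorgan₂ (holds D (T α)) (holds D (T β)))

  holds-T∧ : ∀ D α β → holds D (T (α ∧′ β)) ≡ holds D (T α) ∧ holds D (T β)
  holds-T∧ D α β = ∈-⊓ D (⟦ α ⟧ v) (⟦ β ⟧ v)

  holds-F∧ : ∀ D α β → holds D (F (α ∧′ β)) ≡ holds D (F α) ∨ holds D (F β)
  holds-F∧ D α β = trans (cong not (holds-T∧ D α β)) (deMorgan₁ (holds D (T α)) (holds D (T β)))

  holds-T¬ : ∀ D α → holds D (T (¬′ α)) ≡ holds (opposite D) (F α)
  holds-T¬ D α = ∈-∼ D (⟦ α ⟧ v)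

  holds-F¬ : ∀ D α → holds D (F (¬′ α)) ≡ holds (opposite D) (T α)
  holds-F¬ D α = trans (cong not (holds-T¬ D α)) (not-involutive (holds (opposite D) (T α)))

  holds-T¬¬ : ∀ D α → holds D (T (¬′ ¬′ α)) ≡ holds D (T α)
  holds-T¬¬ D α = cong (_∈ᵇ D) (∼-involutive (⟦ α ⟧ v))

  holds-F¬¬ : ∀ D α → holds D (F (¬′ ¬′ α)) ≡ holds D (F α)
  holds-F¬¬ D α = cong not (holds-T¬¬ D α)

  holds-T□ : ∀ D α → holds D (T (□ α)) ≡ holds D (T α) ∧ holds D (F (¬′ α))
  holds-T□ D α = trans (∈-■ D (⟦ α ⟧ v)) (cong (holds D (T α) ∧_) (sym (holds-F¬ D α)))

  holds-F□ : ∀ D α → holds D (F (□ α)) ≡ holds D (F α) ∨ holds D (T (¬′ α))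
  holds-F□ D α = begin
    not (holds D (T (□ α)))                         ≡⟨ cong not (∈-■ D (⟦ α ⟧ v)) ⟩
    not (holds D (T α) ∧ holds (opposite D) (T α))  ≡⟨ deMorgan₁ (holds D (T α)) _ ⟩
    holds D (F α) ∨ holds (opposite D) (F α)        ≡⟨ cong (holds D (F α) ∨_) (holds-T¬ D α) ⟨
    holds D (F α) ∨ holds D (T (¬′ α))              ∎

  holds-T¬□ : ∀ D α → holds D (T (¬′ □ α)) ≡ holds D (F (□ α))
  holds-T¬□ D α = trans (holds-T¬ D (□ α)) (cong not (∈-■-independent (opposite D) D (⟦ α ⟧ v)))

  holds-F¬□ : ∀ D α → holds D (F (¬′ □ α)) ≡ holds D (T (□ α))
  holds-F¬□ D α = trans (holds-F¬ D (□ α)) (∈-■-independent (opposite D) D (⟦ α ⟧ v))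

  holds-T¬∨ : ∀ D α β → holds D (T (¬′ (α ∨′ β))) ≡ holds D (T (¬′ α)) ∧ holds D (T (¬′ β))
  holds-T¬∨ D α β = begin
    holds D (T (¬′ (α ∨′ β)))                           ≡⟨ holds-T¬ D (α ∨′ β) ⟩
    holds (opposite D) (F (α ∨′ β))                     ≡⟨ holds-F∨ (opposite D) α β ⟩
    holds (opposite D) (F α) ∧ holds (opposite D) (F β) ≡⟨ cong₂ _∧_ (holds-T¬ D α) (holds-T¬ D β) ⟨
    holds D (T (¬′ α)) ∧ holds D (T (¬′ β))             ∎

  holds-F¬∨ : ∀ D α β → holds D (F (¬′ (α ∨′ β))) ≡ holds D (F (¬′ α)) ∨ holds D (F (¬′ β))
  holds-F¬∨ D α β = begin
    holds D (F (¬′ (α ∨′ β)))                           ≡⟨ holds-F¬ D (α ∨′ β) ⟩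
    holds (opposite D) (T (α ∨′ β))                     ≡⟨ holds-T∨ (opposite D) α β ⟩
    holds (opposite D) (T α) ∨ holds (opposite D) (T β) ≡⟨ cong₂ _∨_ (holds-F¬ D α) (holds-F¬ D β) ⟨
    holds D (F (¬′ α)) ∨ holds D (F (¬′ β))             ∎

  holds-T¬∧ : ∀ D α β → holds D (T (¬′ (α ∧′ β))) ≡ holds D (T (¬′ α)) ∨ holds D (T (¬′ β))
  holds-T¬∧ D α β = begin
    holds D (T (¬′ (α ∧′ β)))                           ≡⟨ holds-T¬ D (α ∧′ β) ⟩
    holds (opposite D) (F (α ∧′ β))                     ≡⟨ holds-F∧ (opposite D) α β ⟩
    holds (opposite D) (F α) ∨ holds (opposite D) (F β) ≡⟨ cong₂ _∨_ (holds-T¬ D α) (holds-T¬ D β) ⟨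
    holds D (T (¬′ α)) ∨ holds D (T (¬′ β))             ∎

  holds-F¬∧ : ∀ D α β → holds D (F (¬′ (α ∧′ β))) ≡ holds D (F (¬′ α)) ∧ holds D (F (¬′ β))
  holds-F¬∧ D α β = begin
    holds D (F (¬′ (α ∧′ β)))                           ≡⟨ holds-F¬ D (α ∧′ β) ⟩
    holds (opposite D) (T (α ∧′ β))                     ≡⟨ holds-T∧ (opposite D) α β ⟩
    holds (opposite D) (T α) ∧ holds (opposite D) (T β) ≡⟨ cong₂ _∧_ (holds-F¬ D α) (holds-F¬ D β) ⟨
    holds D (F (¬′ α)) ∧ holds D (F (¬′ β))             ∎

  rule-invertible : ∀ D {φ cs} → Rule φ cs → holds D φ ≡ any (all (holds D)) cs
  rule-invertible D (T∨ α β) =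
    trans (holds-T∨ D α β) (sym (any-all-[x]-[y] (holds D) (T α) (T β)))
  rule-invertible D (T¬∨ α β) =
    trans (holds-T¬∨ D α β) (sym (any-all-[x,y] (holds D) (T (¬′ α)) (T (¬′ β))))
  rule-invertible D (F∨ α β) =
    trans (holds-F∨ D α β) (sym (any-all-[x,y] (holds D) (F α) (F β)))
  rule-invertible D (F¬∨ α β) =
    trans (holds-F¬∨ D α β) (sym (any-all-[x]-[y] (holds D) (F (¬′ α)) (F (¬′ β))))
  rule-invertible D (T∧ α β) =
    trans (holds-T∧ D α β) (sym (any-all-[x,y] (holds D) (T α) (T β)))
  rule-invertible D (T¬∧ α β) =
    trans (holds-T¬∧ D α β) (sym (any-all-[x]-[y] (holds D) (T (¬′ α)) (T (¬′ β))))
  rule-invertible D (F∧ α β) =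
    trans (holds-F∧ D α β) (sym (any-all-[x]-[y] (holds D) (F α) (F β)))
  rule-invertible D (F¬∧ α β) =
    trans (holds-F¬∧ D α β) (sym (any-all-[x,y] (holds D) (F (¬′ α)) (F (¬′ β))))
  rule-invertible D (T¬¬ α) =
    trans (holds-T¬¬ D α) (sym (any-all-[x] (holds D) (T α)))
  rule-invertible D (F¬¬ α) =
    trans (holds-F¬¬ D α) (sym (any-all-[x] (holds D) (F α)))
  rule-invertible D (T□ α) =
    trans (holds-T□ D α) (sym (any-all-[x,y] (holds D) (T α) (F (¬′ α))))
  rule-invertible D (F□ α) =
    trans (holds-F□ D α) (sym (any-all-[x]-[y] (holds D) (F α) (T (¬′ α))))
  rule-invertible D (T¬□ α) =
    trans (holds-T¬□ D α) (sym (any-all-[x] (holds D) (F (□ α))))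
  rule-invertible D (F¬□ α) =
    trans (holds-F¬□ D α) (sym (any-all-[x] (holds D) (T (□ α))))

  rule-sound : ∀ D {φ cs} → Rule φ cs → IsTrue (holds D φ) → Any (All (IsTrue ∘ holds D)) cs
  rule-sound D {cs = cs} r premise =
    Any.map (all⁺ (holds D) _) (any⁻ (all (holds D)) cs (subst IsTrue (rule-invertible D r) premise))

  holds-consistent : ∀ D γ → IsTrue (holds D (T γ)) → ¬ IsTrue (holds D (F γ))
  holds-consistent D γ with ⟦ γ ⟧ v ∈ᵇ D
  ... | true  = λ _ ()
  ... | false = λ ()

  closed-tableau-refutes : ∀ D {η ts} → Tableau η ts → ClosedTableau ts → ¬ IsTrue (holds D η)
  closed-tableau-refutes D =
    TableauSoundness.closed-tableau-refutes (IsTrue ∘ holds D) (rule-sound D) (holds-consistent D)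

corollary6p4 : ∀ (α : Formula) → ⊢T′ α → ⊨TML α
corollary6p4 α (_ , tableau , closed) v =
  in-every-prime-filter⇒≡𝟙 (⟦ α ⟧ v) (λ D → closed-tableau-refutes v D tableau closed)
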